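{- Let $D$ be a digraph with potential function $\phi$. If there exists an undecided vertex $x\in V(D)$ with $\psi(x)\ge 3.75$, then $\mathrm{KFVD}(D,\phi)=\min\{\mathrm{KFVD}(D_1,\phi_1)+|N^+(x)|,\ \mathrm{KFVD}(D_2,\phi_2)\}$, where $(D_1,\phi_1)=update(D,\phi,x,-)$ and $(D_2,\phi_2)=update(D,\phi,-,\{x\})$.
   Context: All digraphs are finite, without loops or parallel arcs; $N^+(v)$ and $N^-(v)$ denote out- and in-neighbourhoods in $D$. A sink is a vertex of out-degree $0$. A knot in a digraph is a strongly connected component of size at least $2$ with no arc leaving it; a digraph is knot-free if it has no knot. A potential function is a map $\phi:V(D)\to\{0.25,1\}$, with $\phi(A)=\sum_{a\in A}\phi(a)$ for $A\subseteq V(D)$; vertices with $\phi(v)=1$ are undecided, their set is $\mathcal{U}$. A set $S\subseteq V(D)$ is a feasible solution for $(D,\phi)$ if $D-S$ (the subgraph induced on $V(D)\setminus S$) is knot-free and every sink $s$ of $D-S$ satisfies $\phi(s)=1$; $\mathrm{KFVD}(D,\phi)$ is the minimum size of a feasible solution. For $v\in V(D)$, $R^-(v)$ is the set of vertices having a directed path to $v$ in $D-N^+(v)$ (so $v\in R^-(v)$), $R(v)=N^+(v)\cup R^-(v)$, $R^+(v)=\{u\in\mathcal{U}: v\in R^-(u)\}$, and $\psi(v)=\phi(R(v))+0.75\,|R^+(v)\setminus R(v)|$. For a vertex $s$, $update(D,\phi,s,-)$ returns $(D-R(s),\phi')$ where $\phi'$ on $V(D)\setminus R(s)$ is $\phi'(v)=0.25$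 if $v\in R^+(s)$ and $\phi'(v)=\phi(v)$ otherwise. For a set $X$, $update(D,\phi,-,X)$ returns $(D,\phi')$ with $\phi'(v)=0.25$ for $v\in X$ and $\phi'(v)=\phi(v)$ otherwise. -}

module Defs where

open import Data.Nat using (ℕ; _+_; _≤_; _*_)
open import Data.Bool using (Bool; true; false; _∧_; if_then_else_)
open import Data.Fin using (Fin; _≟_)
open import Relation.Nullary.Decidable using (does)
open import Data.Fin.Subset using (Subset; _∈_; _∉_; _⊆_; ∁; _∩_; _∪_; _─_; ∣_∣)
open import Data.Vec using (Vec; lookup; tabulate)
open import Data.List using (List; map; allFin)
open import Data.Nat.ListAction using (sum)
open import Data.Product using (Σ; _×_)
open import Relation.Binary.PropositionalEquality using (_≡_)
open import Relation.Nullary using (¬_)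
open import Relation.Binary.Construct.Closure.ReflexiveTransitive using (Star)
open import Function.Bundles using (_⇔_)

-- A finite loopless digraph whose vertex set is a subset V of Fin n.
-- Arcs are the pairs (u,v) with u,v ∈ V, u ≠ v and E u v ≡ true
-- (a Bool-valued adjacency relation, so no parallel arcs).
record Digraph (n : ℕ) : Set where
  field
    V        : Subset n
    E        : Fin n → Fin n → Bool
    loopless : ∀ v → E v v ≡ false
open Digraph public

module _ {n : ℕ} where

  Arc : Digraph n → Fin n → Fin n → Set
  Arc D u v = (u ∈ V D) × (v ∈ V D) × (E D u v ≡ true)

  Path : Digraph n → Fin n → Fin n → Set
  Path D = Star (Arc D)

  _⊝_ : Digraph n → Subset n → Digraph n
  D ⊝ S = record { V = V D ─ S ; E = E D ; loopless = loopless D }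

  N⁺ : Digraph n → Fin n → Subset n
  N⁺ D v = tabulate (λ u → lookup (V D) v ∧ (lookup (V D) u ∧ E D v u))

  IsSCC : Digraph n → Subset n → Set
  IsSCC D C = (C ⊆ V D) ×
    (∀ u w → u ∈ C → (w ∈ C ⇔ ((w ∈ V D) × Path D u w × Path D w u)))

  IsKnot : Digraph n → Subset n → Set
  IsKnot D C = IsSCC D C × (2 ≤ ∣ C ∣) × (∀ u w → u ∈ C → Arc D u w → w ∈ C)

  KnotFree : Digraph n → Set
  KnotFree D = ∀ C → ¬ IsKnot D C

  IsSink : Digraph n → Fin n → Set
  IsSink D s = (s ∈ V D) × (∀ w → ¬ Arc D s w)

-- potential values: quarter = 0.25, one = 1 (undecided)
data Pot : Set where
  quarter one : Pot

-- 4 × the potential value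
pot4 : Pot → ℕ
pot4 quarter = 1
pot4 one     = 4

module _ {n : ℕ} where

  weight4 : (Fin n → Pot) → Subset n → ℕ
  weight4 φ A = sum (map (λ i → if lookup A i then pot4 (φ i) else 0) (allFin n))

  Feasible : Digraph n → (Fin n → Pot) → Subset n → Set
  Feasible D φ S = (S ⊆ V D) × KnotFree (D ⊝ S) × (∀ s → IsSink (D ⊝ S) s → φ s ≡ one)

  IsKFVD : Digraph n → (Fin n → Pot) → ℕ → Set
  IsKFVD D φ k = Σ (Subset n) (λ S → Feasible D φ S × ∣ S ∣ ≡ k)
               × (∀ S → Feasible D φ S → k ≤ ∣ S ∣)

  InR⁻ : Digraph n → Fin n → Fin n → Set
  InR⁻ D v u = (u ∈ V (D ⊝ N⁺ D v)) × Path (D ⊝ N⁺ D v) u v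

  InR⁺ : Digraph n → (Fin n → Pot) → Fin n → Fin n → Set
  InR⁺ D φ v u = (u ∈ V D) × (φ u ≡ one) × InR⁻ D u v

  Rset : Digraph n → Fin n → Subset n → Subset n
  Rset D v Rm = N⁺ D v ∪ Rm

  -- 4 · ψ(v) = 4 φ(R(v)) + 3 |R⁺(v) \ R(v)|, given Rm = R⁻(v), Rp = R⁺(v)
  psi4 : Digraph n → (Fin n → Pot) → Fin n → Subset n → Subset n → ℕ
  psi4 D φ v Rm Rp = weight4 φ (Rset D v Rm) + 3 * ∣ Rp ─ Rset D v Rm ∣

  -- update(D,φ,s,-) potential part: set φ to 0.25 on R⁺(s)
  updPhiSet : (Fin n → Pot) → Subset n → Fin n → Pot
  updPhiSet φ X v = if lookup X v then quarter else φ v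

  updPhiVertex : (Fin n → Pot) → Fin n → Fin n → Pot
  updPhiVertex φ x v = if does (v ≟ x) then quarter else φ v

-- Upper bound: a solution S₁ of the first branch extends to S₁ ∪ N⁺(x), which makes x a sink;
-- every vertex of R⁻(x) still reaches x, so no knot meets R⁻(x) and the only sink there is the
-- undecided x. A solution of the second branch solves (D, φ), since lowering a potential only
-- adds constraints.
-- Lower bound: let S solve (D, φ). If some s ≠ x in R⁺(x) is a sink of D − S, put back into the
-- graph the vertices of a path from x to s in D − N⁺(s): they all drain into s, which remains a
-- sink, so the smaller set solves the second branch. Otherwise S solves the second branch unless
-- x is a sink of D − S; then N⁺(x) ⊆ S, no arc of D − S enters R(x) from outside (R⁻(x) is
-- closed under predecessors in D − N⁺(x)), and S ∖ R(x) solves the first branch.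
{-# OPTIONS --safe #-}
module Submission where

open import Defs
open import Data.Nat using (ℕ; _+_; _≤_; _⊓_; suc; s≤s)
open import Data.Nat.Properties
  using (≤-refl; ≤-trans; ≤-total; +-suc; +-monoˡ-≤; m⊓n≤m; m⊓n≤n; m≤n⇒m⊓n≡m; m≥n⇒m⊓n≡n)
open import Data.Bool using (true; false; _∧_)
open import Data.Bool.Properties using (∧-conicalˡ; ∧-conicalʳ)
import Data.Bool.Properties as Bool
open import Data.Fin using (Fin; _≟_)
open import Data.Fin.Properties using (any?; all?)
open import Data.Fin.Subset using (Subset; _∈_; _∉_; _⊆_; ∣_∣; _∪_; _─_; ⁅_⁆; inside; outside)
open import Data.Fin.Subset.Properties
  using ( _∈?_; p⊆q⇒∣p∣≤∣q∣; p⊆p∪q; q⊆p∪q; x∈p∪q⁻; x∈⁅x⁆; x∈⁅y⁆⇒x≡y; ∣⁅x⁆∣≡1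
        ; x∈p∧x∉q⇒x∈p─q; p─q⊆p; ∣p─q∣≤∣p∣)
open import Data.Vec using ([]; _∷_; lookup; here; there)
open import Data.Vec.Properties using ([]=⇒lookup; lookup⇒[]=; lookup∘tabulate)
open import Data.Product using (Σ; ∃; _×_; _,_; proj₁; proj₂)
open import Data.Sum using (_⊎_; inj₁; inj₂)
open import Data.Empty using (⊥-elim)
open import Relation.Nullary using (¬_; Dec; yes; no)
open import Relation.Nullary.Decidable using (_×-dec_; ¬?)
open import Relation.Binary.PropositionalEquality
  using (_≡_; _≢_; refl; sym; trans; cong; cong₂; subst)
open import Relation.Binary.Construct.Closure.ReflexiveTransitive using (ε; _◅_)
open import Function.Base using (_∘_)
open import Function.Bundles using (_⇔_; mk⇔; Equivalence)

open Equivalence using (to; from)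

x∈p─q⇒x∉q : ∀ {n} {x : Fin n} {p q : Subset n} → x ∈ p ─ q → x ∉ q
x∈p─q⇒x∉q {p = inside ∷ _} {outside ∷ _} here ()
x∈p─q⇒x∉q {p = _ ∷ _} {_ ∷ _} (there x∈p─q) (there x∈q) = x∈p─q⇒x∉q x∈p─q x∈q

∣p∪q∣≡∣p∣+∣q∣ : ∀ {n} (p q : Subset n) → (∀ {x} → x ∈ p → x ∉ q)
              → ∣ p ∪ q ∣ ≡ ∣ p ∣ + ∣ q ∣
∣p∪q∣≡∣p∣+∣q∣ []            []            _        = refl
∣p∪q∣≡∣p∣+∣q∣ (inside  ∷ p) (inside  ∷ q) disjoint = ⊥-elim (disjoint here here)
∣p∪q∣≡∣p∣+∣q∣ (inside  ∷ p) (outside ∷ q) disjoint =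
  cong suc (∣p∪q∣≡∣p∣+∣q∣ p q λ x∈p x∈q → disjoint (there x∈p) (there x∈q))
∣p∪q∣≡∣p∣+∣q∣ (outside ∷ p) (inside  ∷ q) disjoint =
  trans (cong suc (∣p∪q∣≡∣p∣+∣q∣ p q λ x∈p x∈q → disjoint (there x∈p) (there x∈q)))
        (sym (+-suc ∣ p ∣ ∣ q ∣))
∣p∪q∣≡∣p∣+∣q∣ (outside ∷ p) (outside ∷ q) disjoint =
  ∣p∪q∣≡∣p∣+∣q∣ p q λ x∈p x∈q → disjoint (there x∈p) (there x∈q)

x∉p∧x∉q⇒x∉p∪q : ∀ {n} {x : Fin n} {p q : Subset n} → x ∉ p → x ∉ q → x ∉ p ∪ q
x∉p∧x∉q⇒x∉p∪q {p = p} {q} x∉p x∉q x∈p∪q with x∈p∪q⁻ p q x∈p∪q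
... | inj₁ x∈p = x∉p x∈p
... | inj₂ x∈q = x∉q x∈q

∪-lub : ∀ {n} {p q r : Subset n} → p ⊆ r → q ⊆ r → p ∪ q ⊆ r
∪-lub {p = p} {q} p⊆r q⊆r x∈p∪q with x∈p∪q⁻ p q x∈p∪q
... | inj₁ x∈p = p⊆r x∈p
... | inj₂ x∈q = q⊆r x∈q

2≤∣p∣⇒∃≢ : ∀ {n} (p : Subset n) → 2 ≤ ∣ p ∣ → (y : Fin n) → ∃ λ x → x ∈ p × x ≢ y
2≤∣p∣⇒∃≢ p 2≤∣p∣ y with any? (λ x → (x ∈? p) ×-dec ¬? (x ≟ y))
... | yes other = other
... | no none =
  ⊥-elim (2≰1 (≤-trans 2≤∣p∣ (subst (∣ p ∣ ≤_) (∣⁅x⁆∣≡1 y) (p⊆q⇒∣p∣≤∣q∣ p⊆⁅y⁆))))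
  where
  2≰1 : ¬ 2 ≤ 1
  2≰1 (s≤s ())
  p⊆⁅y⁆ : p ⊆ ⁅ y ⁆
  p⊆⁅y⁆ {x} x∈p with x ≟ y
  ... | yes refl = x∈⁅x⁆ y
  ... | no x≢y = ⊥-elim (none (x , x∈p , x≢y))

module _ {n : ℕ} where

  ∈N⁺⇒Arc : ∀ (G : Digraph n) {v u} → u ∈ N⁺ G v → Arc G v u
  ∈N⁺⇒Arc G {v} {u} u∈N⁺v =
    lookup⇒[]= v (V G) (∧-conicalˡ _ _ adjacent) ,
    lookup⇒[]= u (V G) (∧-conicalˡ _ (E G v u) (∧-conicalʳ (lookup (V G) v) _ adjacent)) ,
    ∧-conicalʳ (lookup (V G) u) _ (∧-conicalʳ (lookup (V G) v) _ adjacent)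
    where adjacent = trans (sym (lookup∘tabulate _ u)) ([]=⇒lookup u∈N⁺v)

  Arc⇒∈N⁺ : ∀ (G : Digraph n) {v u} → Arc G v u → u ∈ N⁺ G v
  Arc⇒∈N⁺ G {v} {u} (v∈V , u∈V , e) = lookup⇒[]= u (N⁺ G v)
    (trans (lookup∘tabulate _ u) (cong₂ _∧_ ([]=⇒lookup v∈V) (cong₂ _∧_ ([]=⇒lookup u∈V) e)))

  v∉N⁺v : ∀ (G : Digraph n) v → v ∉ N⁺ G v
  v∉N⁺v G v v∈N⁺v with trans (sym (proj₂ (proj₂ (∈N⁺⇒Arc G v∈N⁺v)))) (loopless G v)
  ... | ()

  sink⇒N⁺⊆ : ∀ (G : Digraph n) {S v} → IsSink (G ⊝ S) v → N⁺ G v ⊆ S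
  sink⇒N⁺⊆ G {S} (v∈V , no-arc) {u} u∈N⁺v with u ∈? S
  ... | yes u∈S = u∈S
  ... | no u∉S with ∈N⁺⇒Arc G u∈N⁺v
  ...   | _ , u∈V , e = ⊥-elim (no-arc u (v∈V , x∈p∧x∉q⇒x∈p─q u∈V u∉S , e))

  N⁺⊆⇒sink : ∀ (G : Digraph n) {S v} → v ∈ V (G ⊝ S) → N⁺ G v ⊆ S → IsSink (G ⊝ S) v
  N⁺⊆⇒sink G {S} v∈V N⁺v⊆S = v∈V , λ u (_ , u∈V , e) →
    x∈p─q⇒x∉q u∈V (N⁺v⊆S (Arc⇒∈N⁺ G (p─q⊆p _ S v∈V , p─q⊆p _ S u∈V , e)))

  arc? : ∀ (G : Digraph n) u w → Dec (Arc G u w)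
  arc? G u w = (u ∈? V G) ×-dec (w ∈? V G) ×-dec (E G u w Bool.≟ true)

  sink? : ∀ (G : Digraph n) v → Dec (IsSink G v)
  sink? G v = (v ∈? V G) ×-dec all? (λ w → ¬? (arc? G v w))

  verts : ∀ (G : Digraph n) {u w} → Path G u w → Subset n
  verts G {w = w} ε = ⁅ w ⁆
  verts G (_◅_ {i = u} _ p) = ⁅ u ⁆ ∪ verts G p

  module _ (G : Digraph n) where

    head∈verts : ∀ {u w} (p : Path G u w) → u ∈ verts G p
    head∈verts {u} ε = x∈⁅x⁆ u
    head∈verts {u} (_ ◅ p) = p⊆p∪q (verts G p) (x∈⁅x⁆ u)

    last∈verts : ∀ {u w} (p : Path G u w) → w ∈ verts G p
    last∈verts {w = w} ε = x∈⁅x⁆ w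
    last∈verts {u} (_ ◅ p) = q⊆p∪q ⁅ u ⁆ (verts G p) (last∈verts p)

    verts⊆ : ∀ {C u w} → (∀ {a b} → a ∈ C → Arc G a b → b ∈ C) → u ∈ C
           → (p : Path G u w) → verts G p ⊆ C
    verts⊆ closed u∈C ε v∈⁅u⁆ with x∈⁅y⁆⇒x≡y _ v∈⁅u⁆
    ... | refl = u∈C
    verts⊆ {u = u} closed u∈C (arc ◅ p) v∈ with x∈p∪q⁻ ⁅ u ⁆ (verts G p) v∈
    ... | inj₁ v∈⁅u⁆ = verts⊆ closed u∈C ε v∈⁅u⁆
    ... | inj₂ v∈p = verts⊆ closed (closed u∈C arc) p v∈p

    verts⊆V : ∀ {u w} → u ∈ V G → (p : Path G u w) → verts G p ⊆ V G
    verts⊆V = verts⊆ λ _ (_ , b∈V , _) → b∈V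

    suffix : ∀ {u w v} (p : Path G u w) → v ∈ verts G p
           → Σ (Path G v w) λ q → verts G q ⊆ verts G p
    suffix ε v∈⁅w⁆ with x∈⁅y⁆⇒x≡y _ v∈⁅w⁆
    ... | refl = ε , λ x∈ → x∈
    suffix {u} (arc ◅ p) v∈ with x∈p∪q⁻ ⁅ u ⁆ (verts G p) v∈
    ... | inj₁ v∈⁅u⁆ with x∈⁅y⁆⇒x≡y u v∈⁅u⁆
    ...   | refl = arc ◅ p , λ x∈ → x∈
    suffix {u} (arc ◅ p) v∈ | inj₂ v∈p with suffix p v∈p
    ... | q , q⊆p = q , λ x∈q → q⊆p∪q ⁅ u ⁆ (verts G p) (q⊆p x∈q)

    sink-path : ∀ {s w} → IsSink G s → Path G s w → s ≡ w
    sink-path _ ε = refl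
    sink-path (_ , no-arc) (arc ◅ _) = ⊥-elim (no-arc _ arc)

    knot-path-closed : ∀ {C u w} → IsKnot G C → u ∈ C → Path G u w → w ∈ C
    knot-path-closed (_ , _ , closed) u∈C p = verts⊆ (closed _ _) u∈C p (last∈verts p)

    sink∉knot : ∀ {C s} → IsKnot G C → s ∈ C → ¬ IsSink G s
    sink∉knot {C} {s} ((_ , scc) , 2≤∣C∣ , _) s∈C s-sink with 2≤∣p∣⇒∃≢ C 2≤∣C∣ s
    ... | w , w∈C , w≢s =
      w≢s (sym (sink-path s-sink (proj₁ (proj₂ (to (scc s w s∈C) w∈C)))))

  arc-transfer : ∀ (G H : Digraph n) → E G ≡ E H
               → ∀ {u w} → u ∈ V H → w ∈ V H → Arc G u w → Arc H u w
  arc-transfer G H same-E {u} {w} u∈V w∈V (_ , _ , e) =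
    u∈V , w∈V , subst (λ F → F u w ≡ true) same-E e

  path-transfer : ∀ (G H : Digraph n) → E G ≡ E H
                → ∀ {u w} (p : Path G u w) → verts G p ⊆ V H → Path H u w
  path-transfer G H same-E ε _ = ε
  path-transfer G H same-E {u} (arc ◅ p) p⊆V =
    arc-transfer G H same-E (p⊆V (head∈verts G (arc ◅ p))) (p-tail⊆V (head∈verts G p)) arc
    ◅ path-transfer G H same-E p p-tail⊆V
    where
    p-tail⊆V : verts G p ⊆ V H
    p-tail⊆V = p⊆V ∘ q⊆p∪q ⁅ u ⁆ (verts G p)

  module _ (G H : Digraph n) (same-E : E G ≡ E H) where

    sink-transfer : ∀ {s} → IsSink H s → s ∈ V G
                  → (∀ {w} → Arc G s w → w ∈ V H) → IsSink G s
    sink-transfer (s∈V , no-arc) s∈V′ stays = s∈V′ , λ w arc →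
      no-arc w (arc-transfer G H same-E s∈V (stays arc) arc)

    knot-transfer : ∀ {C} → IsKnot H C → C ⊆ V G
                  → (∀ {u w} → u ∈ C → Arc G u w → w ∈ V H) → IsKnot G C
    knot-transfer {C} ((C⊆V , scc) , 2≤∣C∣ , closedH) C⊆V′ stays =
      (C⊆V′ , scc′) , 2≤∣C∣ , λ u w u∈C → closedH u w u∈C ∘ arcG⇒H u∈C
      where
      arcG⇒H : ∀ {u w} → u ∈ C → Arc G u w → Arc H u w
      arcG⇒H u∈C arc = arc-transfer G H same-E (C⊆V u∈C) (stays u∈C arc) arc
      pathH⇒G : ∀ {u w} → u ∈ C → Path H u w → Path G u w
      pathH⇒G u∈C p = path-transfer H G (sym same-E) p
        (λ x∈p → C⊆V′ (verts⊆ H (λ {a} {b} → closedH a b) u∈C p x∈p))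
      scc′ : ∀ u w → u ∈ C → (w ∈ C ⇔ ((w ∈ V G) × Path G u w × Path G w u))
      scc′ u w u∈C = mk⇔
        (λ w∈C → let (_ , u→w , w→u) = to (scc u w u∈C) w∈C
                 in C⊆V′ w∈C , pathH⇒G u∈C u→w , pathH⇒G w∈C w→u)
        (λ (_ , u→w , _) → verts⊆ G (λ a∈C → closedH _ _ a∈C ∘ arcG⇒H a∈C) u∈C u→w
                                    (last∈verts G u→w))

module _ {n : ℕ} (φ : Fin n → Pot) where

  updPhiSet≡one⇒≡one : ∀ X {t} → updPhiSet φ X t ≡ one → φ t ≡ one
  updPhiSet≡one⇒≡one X {t} φ₁t≡one with lookup X t
  ... | false = φ₁t≡one

  updPhiSet≡one : ∀ {X t} → t ∉ X → φ t ≡ one → updPhiSet φ X t ≡ one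
  updPhiSet≡one {X} {t} t∉X φt≡one with lookup X t in eq
  ... | true = ⊥-elim (t∉X (lookup⇒[]= t X eq))
  ... | false = φt≡one

  updPhiVertex≡one⇒≡one : ∀ x {t} → updPhiVertex φ x t ≡ one → φ t ≡ one
  updPhiVertex≡one⇒≡one x {t} φ₂t≡one with t ≟ x
  ... | no _ = φ₂t≡one

  updPhiVertex≡one : ∀ {x t} → t ≢ x → φ t ≡ one → updPhiVertex φ x t ≡ one
  updPhiVertex≡one {x} {t} t≢x φt≡one with t ≟ x
  ... | yes t≡x = ⊥-elim (t≢x t≡x)
  ... | no _ = φt≡one

module Branch {n : ℕ} (D : Digraph n) (φ : Fin n → Pot)
  {x : Fin n} (x∈V : x ∈ V D) (φx≡one : φ x ≡ one)
  {R⁻ : Subset n} (R⁻-spec : ∀ u → u ∈ R⁻ ⇔ InR⁻ D x u)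
  {R⁺ : Subset n} (R⁺-spec : ∀ u → u ∈ R⁺ ⇔ InR⁺ D φ x u) where

  N R : Subset n
  N = N⁺ D x
  R = Rset D x R⁻

  D₁ : Digraph n
  D₁ = D ⊝ R

  φ₁ φ₂ : Fin n → Pot
  φ₁ = updPhiSet φ R⁺
  φ₂ = updPhiVertex φ x

  N⊆R : N ⊆ R
  N⊆R = p⊆p∪q R⁻

  R⁻⊆R : R⁻ ⊆ R
  R⁻⊆R = q⊆p∪q N R⁻

  R⁻⊆V : R⁻ ⊆ V (D ⊝ N)
  R⁻⊆V {u} u∈R⁻ = proj₁ (to (R⁻-spec u) u∈R⁻)

  R⁻-path : ∀ {u} → u ∈ R⁻ → Path (D ⊝ N) u x
  R⁻-path {u} u∈R⁻ = proj₂ (to (R⁻-spec u) u∈R⁻)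

  x∈R⁻ : x ∈ R⁻
  x∈R⁻ = from (R⁻-spec x) (x∈p∧x∉q⇒x∈p─q x∈V (v∉N⁺v D x) , ε)

  R⁻-backward : ∀ {u w} → Arc (D ⊝ N) u w → w ∈ R⁻ → u ∈ R⁻
  R⁻-backward {u} arc w∈R⁻ = from (R⁻-spec u) (proj₁ arc , arc ◅ R⁻-path w∈R⁻)

  verts⊆R⁻ : ∀ {u} (p : Path (D ⊝ N) u x) → verts (D ⊝ N) p ⊆ R⁻
  verts⊆R⁻ ε v∈⁅x⁆ with x∈⁅y⁆⇒x≡y x v∈⁅x⁆
  ... | refl = x∈R⁻
  verts⊆R⁻ {u} (arc ◅ p) v∈ with x∈p∪q⁻ ⁅ u ⁆ (verts (D ⊝ N) p) v∈
  ... | inj₂ v∈p = verts⊆R⁻ p v∈p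
  ... | inj₁ v∈⁅u⁆ with x∈⁅y⁆⇒x≡y u v∈⁅u⁆
  ...   | refl = R⁻-backward arc (verts⊆R⁻ p (head∈verts (D ⊝ N) p))

  module Extend {S₁ : Subset n} (F₁ : Feasible D₁ φ₁ S₁) where

    H : Digraph n
    H = D ⊝ (S₁ ∪ N)

    S₁∩R≡∅ : ∀ {v} → v ∈ S₁ → v ∉ R
    S₁∩R≡∅ v∈S₁ = x∈p─q⇒x∉q (proj₁ F₁ v∈S₁)

    R⁻⊆VH : R⁻ ⊆ V H
    R⁻⊆VH v∈R⁻ = x∈p∧x∉q⇒x∈p─q (p─q⊆p _ N (R⁻⊆V v∈R⁻))
      (x∉p∧x∉q⇒x∉p∪q (λ v∈S₁ → S₁∩R≡∅ v∈S₁ (R⁻⊆R v∈R⁻)) (x∈p─q⇒x∉q (R⁻⊆V v∈R⁻)))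

    V₁⊆VH : V (D₁ ⊝ S₁) ⊆ V H
    V₁⊆VH v∈V₁ = x∈p∧x∉q⇒x∈p─q (p─q⊆p _ R (p─q⊆p _ S₁ v∈V₁))
      (x∉p∧x∉q⇒x∉p∪q (x∈p─q⇒x∉q v∈V₁) (x∈p─q⇒x∉q (p─q⊆p _ S₁ v∈V₁) ∘ N⊆R))

    VH∖R⁻⊆V₁ : ∀ {v} → v ∈ V H → v ∉ R⁻ → v ∈ V (D₁ ⊝ S₁)
    VH∖R⁻⊆V₁ v∈VH v∉R⁻ = x∈p∧x∉q⇒x∈p─q
      (x∈p∧x∉q⇒x∈p─q (p─q⊆p _ _ v∈VH) (x∉p∧x∉q⇒x∉p∪q (v∉S₁∪N ∘ q⊆p∪q S₁ N) v∉R⁻))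
      (v∉S₁∪N ∘ p⊆p∪q N)
      where v∉S₁∪N = x∈p─q⇒x∉q v∈VH

    x-sink : IsSink H x
    x-sink = N⁺⊆⇒sink D (R⁻⊆VH x∈R⁻) (q⊆p∪q S₁ N)

    R⁻-path-in-H : ∀ {u} → u ∈ R⁻ → Path H u x
    R⁻-path-in-H u∈R⁻ =
      path-transfer (D ⊝ N) H refl (R⁻-path u∈R⁻) (R⁻⊆VH ∘ verts⊆R⁻ (R⁻-path u∈R⁻))

    stays-in-H : ∀ {u w} → Arc (D₁ ⊝ S₁) u w → w ∈ V H
    stays-in-H (_ , w∈V₁ , _) = V₁⊆VH w∈V₁

    knot-free : KnotFree H
    knot-free C K = proj₁ (proj₂ F₁) C
      (knot-transfer (D₁ ⊝ S₁) H refl K (λ u∈C → VH∖R⁻⊆V₁ (proj₁ (proj₁ K) u∈C) (C∩R⁻≡∅ u∈C))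
                     (λ _ → stays-in-H))
      where
      C∩R⁻≡∅ : ∀ {u} → u ∈ C → u ∉ R⁻
      C∩R⁻≡∅ u∈C u∈R⁻ = sink∉knot H K (knot-path-closed H K u∈C (R⁻-path-in-H u∈R⁻)) x-sink

    sinks-undecided : ∀ t → IsSink H t → φ t ≡ one
    sinks-undecided t t-sink with t ∈? R⁻
    ... | yes t∈R⁻ =
      subst (λ v → φ v ≡ one) (sym (sink-path H t-sink (R⁻-path-in-H t∈R⁻))) φx≡one
    ... | no t∉R⁻ = updPhiSet≡one⇒≡one φ R⁺ (proj₂ (proj₂ F₁) t
      (sink-transfer (D₁ ⊝ S₁) H refl t-sink (VH∖R⁻⊆V₁ (proj₁ t-sink) t∉R⁻) stays-in-H))

    feasible : Feasible D φ (S₁ ∪ N)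
    feasible =
      ∪-lub (p─q⊆p _ R ∘ proj₁ F₁) (proj₁ ∘ proj₂ ∘ ∈N⁺⇒Arc D) , knot-free , sinks-undecided

    size : ∣ S₁ ∪ N ∣ ≡ ∣ S₁ ∣ + ∣ N ∣
    size = ∣p∪q∣≡∣p∣+∣q∣ S₁ N λ v∈S₁ → S₁∩R≡∅ v∈S₁ ∘ N⊆R

  module ViaOtherSink {S : Subset n} (F : Feasible D φ S)
    {s : Fin n} (s∈R⁺ : s ∈ R⁺) (s≢x : s ≢ x) (s-sink : IsSink (D ⊝ S) s) where

    Gₛ : Digraph n
    Gₛ = D ⊝ N⁺ D s

    x→s : Path Gₛ x s
    x→s = proj₂ (proj₂ (proj₂ (to (R⁺-spec s) s∈R⁺)))

    P : Subset n
    P = verts Gₛ x→s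

    H : Digraph n
    H = D ⊝ (S ─ P)

    P⊆VGₛ : P ⊆ V Gₛ
    P⊆VGₛ = verts⊆V Gₛ (proj₁ (proj₂ (proj₂ (to (R⁺-spec s) s∈R⁺)))) x→s

    P⊆VH : P ⊆ V H
    P⊆VH v∈P = x∈p∧x∉q⇒x∈p─q (p─q⊆p _ _ (P⊆VGₛ v∈P)) (λ v∈S─P → x∈p─q⇒x∉q v∈S─P v∈P)

    VS⊆VH : V (D ⊝ S) ⊆ V H
    VS⊆VH v∈VS = x∈p∧x∉q⇒x∈p─q (p─q⊆p _ S v∈VS) (x∈p─q⇒x∉q v∈VS ∘ p─q⊆p S P)

    VH∖P⊆VS : ∀ {v} → v ∈ V H → v ∉ P → v ∈ V (D ⊝ S)
    VH∖P⊆VS v∈VH v∉P =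
      x∈p∧x∉q⇒x∈p─q (p─q⊆p _ _ v∈VH) (λ v∈S → x∈p─q⇒x∉q v∈VH (x∈p∧x∉q⇒x∈p─q v∈S v∉P))

    stays-in-H : ∀ {u w} → Arc (D ⊝ S) u w → w ∈ V H
    stays-in-H (_ , w∈VS , _) = VS⊆VH w∈VS

    P-path-in-H : ∀ {v} → v ∈ P → Path H v s
    P-path-in-H v∈P with suffix Gₛ x→s v∈P
    ... | q , q⊆P = path-transfer Gₛ H refl q (P⊆VH ∘ q⊆P)

    s-sink-in-H : IsSink H s
    s-sink-in-H = N⁺⊆⇒sink D (VS⊆VH (proj₁ s-sink)) λ v∈N⁺s →
      x∈p∧x∉q⇒x∈p─q (sink⇒N⁺⊆ D s-sink v∈N⁺s) (λ v∈P → x∈p─q⇒x∉q (P⊆VGₛ v∈P) v∈N⁺s)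

    knot-free : KnotFree H
    knot-free C K = proj₁ (proj₂ F) C
      (knot-transfer (D ⊝ S) H refl K (λ u∈C → VH∖P⊆VS (proj₁ (proj₁ K) u∈C) (C∩P≡∅ u∈C))
                     (λ _ → stays-in-H))
      where
      C∩P≡∅ : ∀ {u} → u ∈ C → u ∉ P
      C∩P≡∅ u∈C u∈P = sink∉knot H K (knot-path-closed H K u∈C (P-path-in-H u∈P)) s-sink-in-H

    sinks-undecided : ∀ t → IsSink H t → φ₂ t ≡ one
    sinks-undecided t t-sink with t ∈? P
    ... | yes t∈P = subst (λ v → φ₂ v ≡ one) (sym (sink-path H t-sink (P-path-in-H t∈P)))
      (updPhiVertex≡one φ s≢x (proj₁ (proj₂ (to (R⁺-spec s) s∈R⁺))))
    ... | no t∉P = updPhiVertex≡one φ (λ { refl → t∉P (head∈verts Gₛ x→s) })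
      (proj₂ (proj₂ F) t (sink-transfer (D ⊝ S) H refl t-sink (VH∖P⊆VS (proj₁ t-sink) t∉P) stays-in-H))

    feasible : Feasible D φ₂ (S ─ P)
    feasible = proj₁ F ∘ p─q⊆p S P , knot-free , sinks-undecided

  module WithoutOtherSink {S : Subset n} (F : Feasible D φ S) (x-sink : IsSink (D ⊝ S) x)
                          (no-other-sink : ∀ {s} → s ∈ R⁺ → s ≢ x → ¬ IsSink (D ⊝ S) s) where

    H : Digraph n
    H = D₁ ⊝ (S ─ R)

    N⊆S : N ⊆ S
    N⊆S = sink⇒N⁺⊆ D x-sink

    VH∩R≡∅ : ∀ {v} → v ∈ V H → v ∉ R
    VH∩R≡∅ v∈VH = x∈p─q⇒x∉q (p─q⊆p _ _ v∈VH)

    VH⊆VS : V H ⊆ V (D ⊝ S)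
    VH⊆VS v∈VH = x∈p∧x∉q⇒x∈p─q (p─q⊆p _ R (p─q⊆p _ _ v∈VH))
      (λ v∈S → x∈p─q⇒x∉q v∈VH (x∈p∧x∉q⇒x∈p─q v∈S (VH∩R≡∅ v∈VH)))

    stays-in-H : ∀ {u w} → u ∈ V H → Arc (D ⊝ S) u w → w ∈ V H
    stays-in-H {u} {w} u∈VH (_ , w∈VS , e) =
      x∈p∧x∉q⇒x∈p─q (x∈p∧x∉q⇒x∈p─q w∈V w∉R) (x∈p─q⇒x∉q w∈VS ∘ p─q⊆p S R)
      where
      w∈V = p─q⊆p _ S w∈VS
      w∉N : w ∉ N
      w∉N = x∈p─q⇒x∉q w∈VS ∘ N⊆S
      u∈V-N : u ∈ V (D ⊝ N)
      u∈V-N = x∈p∧x∉q⇒x∈p─q (p─q⊆p _ S (VH⊆VS u∈VH)) (VH∩R≡∅ u∈VH ∘ N⊆R)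
      w∉R : w ∉ R
      w∉R = x∉p∧x∉q⇒x∉p∪q w∉N λ w∈R⁻ →
        VH∩R≡∅ u∈VH (R⁻⊆R (R⁻-backward (u∈V-N , x∈p∧x∉q⇒x∈p─q w∈V w∉N , e) w∈R⁻))

    sink-in-D⊝S : ∀ {t} → IsSink H t → IsSink (D ⊝ S) t
    sink-in-D⊝S t-sink =
      sink-transfer (D ⊝ S) H refl t-sink (VH⊆VS (proj₁ t-sink)) (stays-in-H (proj₁ t-sink))

    sinks-undecided : ∀ t → IsSink H t → φ₁ t ≡ one
    sinks-undecided t t-sink with t ∈? R⁺
    ... | yes t∈R⁺ = ⊥-elim (no-other-sink t∈R⁺ (λ { refl → VH∩R≡∅ (proj₁ t-sink) (R⁻⊆R x∈R⁻) })
                                            (sink-in-D⊝S t-sink))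
    ... | no t∉R⁺ = updPhiSet≡one φ t∉R⁺ (proj₂ (proj₂ F) t (sink-in-D⊝S t-sink))

    feasible : Feasible D₁ φ₁ (S ─ R)
    feasible =
      (λ v∈S─R → x∈p∧x∉q⇒x∈p─q (proj₁ F (p─q⊆p S R v∈S─R)) (x∈p─q⇒x∉q v∈S─R)) ,
      (λ C K → proj₁ (proj₂ F) C
        (knot-transfer (D ⊝ S) H refl K (VH⊆VS ∘ proj₁ (proj₁ K)) (stays-in-H ∘ proj₁ (proj₁ K)))) ,
      sinks-undecided

    size : ∣ S ─ R ∣ + ∣ N ∣ ≤ ∣ S ∣
    size = subst (_≤ ∣ S ∣) (∣p∪q∣≡∣p∣+∣q∣ (S ─ R) N λ v∈S─R → x∈p─q⇒x∉q v∈S─R ∘ N⊆R)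
                 (p⊆q⇒∣p∣≤∣q∣ (∪-lub (p─q⊆p S R) N⊆S))

  relax : ∀ {S} → Feasible D φ₂ S → Feasible D φ S
  relax (S⊆V , knot-free , sinks) =
    S⊆V , knot-free , λ t t-sink → updPhiVertex≡one⇒≡one φ x (sinks t t-sink)

  shrink : ∀ {S} → Feasible D φ S
         → (∃ λ S₂ → Feasible D φ₂ S₂ × ∣ S₂ ∣ ≤ ∣ S ∣)
         ⊎ (∃ λ S₁ → Feasible D₁ φ₁ S₁ × ∣ S₁ ∣ + ∣ N ∣ ≤ ∣ S ∣)
  shrink {S} F with any? (λ s → (s ∈? R⁺) ×-dec ¬? (s ≟ x) ×-dec sink? (D ⊝ S) s)
  ... | yes (s , s∈R⁺ , s≢x , s-sink) =
    inj₁ (_ , ViaOtherSink.feasible F s∈R⁺ s≢x s-sink , ∣p─q∣≤∣p∣ S _)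
  ... | no no-other-sink with sink? (D ⊝ S) x
  ...   | yes x-sink = inj₂ (S ─ R , WithoutOtherSink.feasible F x-sink no-other-sink′ ,
                                     WithoutOtherSink.size F x-sink no-other-sink′)
    where no-other-sink′ = λ {s} s∈R⁺ s≢x s-sink → no-other-sink (s , s∈R⁺ , s≢x , s-sink)
  ...   | no x-not-sink = inj₁ (S , (proj₁ F , proj₁ (proj₂ F) , sinks-undecided) , ≤-refl)
    where
    sinks-undecided : ∀ t → IsSink (D ⊝ S) t → φ₂ t ≡ one
    sinks-undecided t t-sink =
      updPhiVertex≡one φ (λ { refl → x-not-sink t-sink }) (proj₂ (proj₂ F) t t-sink)

lemma1 : ∀ {n} (D : Digraph n) (φ : Fin n → Pot) (x : Fin n)
    → x ∈ V D → φ x ≡ one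
    → (Rm : Subset n) → (∀ u → u ∈ Rm ⇔ InR⁻ D x u)
    → (Rp : Subset n) → (∀ u → u ∈ Rp ⇔ InR⁺ D φ x u)
    → 15 ≤ psi4 D φ x Rm Rp
    → (k₁ k₂ : ℕ)
    → IsKFVD (D ⊝ Rset D x Rm) (updPhiSet φ Rp) k₁
    → IsKFVD D (updPhiVertex φ x) k₂
    → IsKFVD D φ ((k₁ + ∣ N⁺ D x ∣) ⊓ k₂)
-- The bound on ψ(x) only matters for the running time of the branching algorithm.
lemma1 {n} D φ x x∈V φx≡one Rm Rm-spec Rp Rp-spec _ k₁ k₂
       ((S₁ , F₁ , ∣S₁∣≡k₁) , min₁) ((S₂ , F₂ , ∣S₂∣≡k₂) , min₂) =
  optimum , lower-bound
  where
  open Branch D φ x∈V φx≡one Rm-spec Rp-spec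
  optimum : Σ (Subset n) λ S → Feasible D φ S × ∣ S ∣ ≡ (k₁ + ∣ N ∣) ⊓ k₂
  optimum with ≤-total (k₁ + ∣ N ∣) k₂
  ... | inj₁ le = S₁ ∪ N , Extend.feasible F₁ ,
                  trans (Extend.size F₁) (trans (cong (_+ ∣ N ∣) ∣S₁∣≡k₁) (sym (m≤n⇒m⊓n≡m le)))
  ... | inj₂ ge = S₂ , relax F₂ , trans ∣S₂∣≡k₂ (sym (m≥n⇒m⊓n≡n ge))
  lower-bound : ∀ S → Feasible D φ S → (k₁ + ∣ N ∣) ⊓ k₂ ≤ ∣ S ∣
  lower-bound S F with shrink F
  ... | inj₁ (S₂′ , F₂′ , ≤∣S∣) = ≤-trans (m⊓n≤n _ k₂) (≤-trans (min₂ S₂′ F₂′) ≤∣S∣)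
  ... | inj₂ (S₁′ , F₁′ , ≤∣S∣) =
    ≤-trans (m⊓n≤m _ k₂) (≤-trans (+-monoˡ-≤ ∣ N ∣ (min₁ S₁′ F₁′)) ≤∣S∣)
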